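{- Let $\Sigma$ be an alphabet with $|\Sigma|=2$. For every $w\in\Sigma^+$, $\mathrm{cpr}_R(w)=\mathrm{cpr}_L(w)$.
   Context: $\Sigma^*$ is the set of words over $\Sigma$, $\lambda$ the empty word, $\Sigma^+=\Sigma^*\setminus\{\lambda\}$, $|v|$ the length of $v$. Right decomposition. For $w\in\Sigma^+$ let $R_w=\{(u,v,n)\in\Sigma^*\times\Sigma^+\times\mathbb{Z}^+ : w=uv^n\}$ and $\tau_r(w)=\max\{n : (u,v,n)\in R_w\}$. Define $\theta_r(w)$: if $\tau_r(w)=1$, $\theta_r(w)$ is the minimum of $\{|v| : v\in\Sigma^+,\ w=uv \text{ for some } u\in\Sigma^+ \text{ with } \tau_r(u)\neq 1\}$ if this set is nonempty, and $\theta_r(w)=|w|$ otherwise; if $\tau_r(w)>1$, $\theta_r(w)$ is the maximum of $\{|v| : v\in\Sigma^+,\ w=uv^{\tau_r(w)} \text{ for some } u\in\Sigma^*\}$. Let $\rho_r(w)=(u',v',\tau_r(w))$ be the unique element of $R_w$ with $|v'|=\theta_r(w)$. Set $w_0=w$, $(w_1,v_0,n_0)=\rho_r(w_0)$, and recursively $(w_{i+1},v_i,n_i)=\rho_r(w_i)$ while $w_i\neq\lambda$; let $k$ be the largest index with $w_k\ne\lambda$. The right general print is $\mathrm{gpr}_R(w)=v_kv_{k-1}\cdots v_0$. Left decomposition (mirror analogue, from left to right). For $w\in\Sigma^+$ let $L_w=\{(u,v,n)\in\Sigma^*\times\Sigma^+\times\mathbb{Z}^+ : w=v^nu\}$ and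 $\tau_l(w)=\max\{n:(u,v,n)\in L_w\}$. If $\tau_l(w)=1$, $\theta_l(w)$ is the minimum of $\{|v| : v\in\Sigma^+,\ w=vu \text{ for some } u\in\Sigma^+ \text{ with } \tau_l(u)\ne 1\}$ if nonempty, and $|w|$ otherwise; if $\tau_l(w)>1$, $\theta_l(w)$ is the maximum of $\{|v| : v\in\Sigma^+,\ w=v^{\tau_l(w)}u \text{ for some } u\in\Sigma^*\}$. Let $\rho_l(w)=(u',v',\tau_l(w))$ be the unique element of $L_w$ with $|v'|=\theta_l(w)$. Set $w_0=w$, $(w_1,u_0,m_0)=\rho_l(w_0)$, recursively $(w_{i+1},u_i,m_i)=\rho_l(w_i)$ while $w_i\ne\lambda$; with $j$ the largest index with $w_j\ne\lambda$, the left general print is $\mathrm{gpr}_L(w)=u_0u_1\cdots u_j$. Core prints. Let $w_0=w'_0=w$ and recursively $w_{i+1}=\mathrm{gpr}_R(w_i)$, $w'_{i+1}=\mathrm{gpr}_L(w'_i)$. If $I$ (resp. $I'$) is the least nonnegative integer with $w_I=w_{I+1}$ (resp. $w'_{I'}=w'_{I'+1}$), then the right core print is $\mathrm{cpr}_R(w)=w_I$ and the left core print is $\mathrm{cpr}_L(w)=w'_{I'}$. -}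

module Defs where

open import Level using (Level)
open import Data.Bool using (Bool; true; false; _∧_; not; if_then_else_)
open import Data.Nat using (ℕ; zero; suc; _*_; _∸_; _<_; _≤ᵇ_; _<ᵇ_; _≡ᵇ_)
open import Data.Maybe using (Maybe; just; nothing)
open import Data.Product using (Σ; _×_; _,_; proj₁; proj₂)
open import Data.List using (List; []; _∷_; _++_; length; take; drop)
open import Data.List.Properties using (≡-dec)
open import Relation.Nullary using (¬_)
open import Relation.Nullary.Decidable using (⌊_⌋)
open import Relation.Binary.Definitions using (DecidableEquality)
open import Relation.Binary.PropositionalEquality using (_≡_)

iter : ∀ {a} {X : Set a} → (X → X) → ℕ → X → X
iter f zero x = x
iter f (suc n) x = f (iter f n x)

-- largest k with 1 ≤ k ≤ b and p k; 0 if none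
maxBelow : (ℕ → Bool) → ℕ → ℕ
maxBelow p zero = 0
maxBelow p (suc b) = if p (suc b) then suc b else maxBelow p b

minBelow : (ℕ → Bool) → ℕ → Maybe ℕ
minBelow p zero = nothing
minBelow p (suc b) with minBelow p b
... | just k = just k
... | nothing = if p (suc b) then just (suc b) else nothing

anyBelow : (ℕ → Bool) → ℕ → Bool
anyBelow p zero = false
anyBelow p (suc b) = if p (suc b) then true else anyBelow p b

-- Words over an alphabet A with decidable equality (words = lists, λ = [])
module Words {a : Level} {A : Set a} (_≟_ : DecidableEquality A) where

  Word : Set a
  Word = List A

  pow : Word → ℕ → Word
  pow v zero = []
  pow v (suc n) = v ++ pow v n

  _==_ : Word → Word → Bool
  u == v = ⌊ ≡-dec _≟_ u v ⌋

  suffix : ℕ → Word → Word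
  suffix k w = drop (length w ∸ k) w

  prefixWithout : ℕ → Word → Word
  prefixWithout k w = take (length w ∸ k) w

  hasRightPow : Word → ℕ → ℕ → Bool
  hasRightPow w n ℓ = ((n * ℓ) ≤ᵇ length w) ∧ (suffix (n * ℓ) w == pow (suffix ℓ w) n)

  -- τ_r(w): max n with w = u v^n, v ≠ λ  (n, |v| range over 1..|w|)
  τr : Word → ℕ
  τr w = maxBelow (λ n → anyBelow (λ ℓ → hasRightPow w n ℓ) (length w)) (length w)

  θr : Word → ℕ
  θr w with τr w ≡ᵇ 1
  ... | true with minBelow (λ ℓ → (ℓ <ᵇ length w) ∧ not (τr (prefixWithout ℓ w) ≡ᵇ 1)) (length w)
  ...   | just ℓ = ℓ
  ...   | nothing = length w
  θr w | false = maxBelow (λ ℓ → hasRightPow w (τr w) ℓ) (length w)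

  -- ρ_r(w) = (u', v', τ_r(w)) with w = u' v'^{τ_r(w)} and |v'| = θ_r(w)
  ρr : Word → Word × Word × ℕ
  ρr w = prefixWithout (θr w * τr w) w , suffix (θr w) w , τr w

  -- gpr_R with fuel (fuel |w| suffices: each step removes ≥ 1 letter)
  gprRF : ℕ → Word → Word
  gprRF zero w = []
  gprRF (suc f) [] = []
  gprRF (suc f) (x ∷ w) =
    gprRF f (proj₁ (ρr (x ∷ w))) ++ proj₁ (proj₂ (ρr (x ∷ w)))

  gprR : Word → Word
  gprR w = gprRF (length w) w

  hasLeftPow : Word → ℕ → ℕ → Bool
  hasLeftPow w n ℓ = ((n * ℓ) ≤ᵇ length w) ∧ (take (n * ℓ) w == pow (take ℓ w) n)

  τl : Word → ℕ
  τl w = maxBelow (λ n → anyBelow (λ ℓ → hasLeftPow w n ℓ) (length w)) (length w)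

  θl : Word → ℕ
  θl w with τl w ≡ᵇ 1
  ... | true with minBelow (λ ℓ → (ℓ <ᵇ length w) ∧ not (τl (drop ℓ w) ≡ᵇ 1)) (length w)
  ...   | just ℓ = ℓ
  ...   | nothing = length w
  θl w | false = maxBelow (λ ℓ → hasLeftPow w (τl w) ℓ) (length w)

  -- ρ_l(w) = (u', v', τ_l(w)) with w = v'^{τ_l(w)} u' and |v'| = θ_l(w)
  ρl : Word → Word × Word × ℕ
  ρl w = drop (θl w * τl w) w , take (θl w) w , τl w

  gprLF : ℕ → Word → Word
  gprLF zero w = []
  gprLF (suc f) [] = []
  gprLF (suc f) (x ∷ w) =
    proj₁ (proj₂ (ρl (x ∷ w))) ++ gprLF f (proj₁ (ρl (x ∷ w)))

  gprL : Word → Word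
  gprL w = gprLF (length w) w

  IsCorePrint : (Word → Word) → Word → Word → Set a
  IsCorePrint g w c =
    Σ ℕ λ I → (iter g I w ≡ c) × (g c ≡ c)
      × (∀ J → J < I → ¬ (iter g J w ≡ iter g (suc J) w))

  IsCprR : Word → Word → Set a
  IsCprR = IsCorePrint gprR

  IsCprL : Word → Word → Set a
  IsCprL = IsCorePrint gprL

-- gpr_R and gpr_L only ever replace a factor v^n by v. Hence they never lengthen a word, and
-- they keep its first letter, its last letter and its set of letters; so iterating either one
-- stops, at a core print sharing these three data with w. In a word fixed by gpr_R every
-- decomposition step has exponent 1, which forces τ_r = 1 on every nonempty prefix: no prefix
-- ends in a square. Dually no suffix of a gpr_L-fixed word starts with a square. Over two
-- letters the only such words are x, xy and xyx, and these are determined by their first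
-- letter, last letter and set of letters.
module Submission where

open import Defs
open import Data.Bool using (Bool; true; false; T; not; _∧_)
open import Data.Bool.Properties using (T-≡; T-∧; T-not-≡)
open import Data.Empty using (⊥-elim)
open import Data.Fin using (Fin; zero; suc)
open import Data.List using (List; []; _∷_; _++_; length; take; drop; head; last)
open import Data.List.Membership.Propositional using (_∈_)
open import Data.List.Membership.Propositional.Properties using (∈-++⁻)
open import Data.List.Properties
  using (≡-dec; length-++; length-++-comm; length-take; length-drop; take-all; take++drop≡id; ++-identityʳ)
open import Data.List.Relation.Binary.Subset.Propositional using (_⊆_)
open import Data.List.Relation.Binary.Subset.Propositional.Properties using (⊆-refl; ⊆-trans; ++⁺; xs⊆xs++ys)
open import Data.List.Relation.Unary.Any using (here; there)
open import Data.Maybe using (just; nothing; _<∣>_)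
open import Data.Maybe.Properties using (<∣>-identityʳ)
open import Data.Nat
  using (ℕ; zero; suc; _+_; _*_; _∸_; _<_; _≤_; _<ᵇ_; _≡ᵇ_; s≤s; z<s; s<s; s≤s⁻¹; s<s⁻¹; >-nonZero)
open import Data.Nat.Properties
open import Data.Product using (Σ; ∃; _×_; _,_; proj₁; proj₂)
open import Data.Sum using (_⊎_; inj₁; inj₂)
open import Function.Base using (_∘_)
open import Function.Bundles using (_↔_; Equivalence; Injection)
open import Function.Properties.Inverse using (↔⇒↣)
open import Relation.Nullary using (¬_; yes; no; contradiction)
open import Relation.Nullary.Decidable using (toWitness; fromWitness)
open import Relation.Binary.Definitions using (DecidableEquality)
open import Relation.Binary.PropositionalEquality

maxBelow-maximal : ∀ p b {k} → T (p k) → 1 ≤ k → k ≤ b → k ≤ maxBelow p b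
maxBelow-maximal p zero pk 1≤k k≤0 = contradiction k≤0 (<⇒≱ 1≤k)
maxBelow-maximal p (suc b) pk 1≤k k≤1+b with p (suc b) in e
... | true = k≤1+b
... | false with m≤n⇒m<n∨m≡n k≤1+b
...   | inj₁ k<1+b = maxBelow-maximal p b pk 1≤k (s≤s⁻¹ k<1+b)
...   | inj₂ refl = ⊥-elim (subst T e pk)

maxBelow-satisfies : ∀ p b → 1 ≤ maxBelow p b → T (p (maxBelow p b))
maxBelow-satisfies p (suc b) 1≤max with p (suc b) in e
... | true = Equivalence.from T-≡ e
... | false = maxBelow-satisfies p b 1≤max

anyBelow-sound : ∀ p b → T (anyBelow p b) → ∃ λ ℓ → 1 ≤ ℓ × ℓ ≤ b × T (p ℓ)
anyBelow-sound p (suc b) any with p (suc b) in e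
... | true = suc b , z<s , ≤-refl , Equivalence.from T-≡ e
... | false with anyBelow-sound p b any
...   | ℓ , 1≤ℓ , ℓ≤b , pℓ = ℓ , 1≤ℓ , m≤n⇒m≤1+n ℓ≤b , pℓ

anyBelow-complete : ∀ p b {ℓ} → T (p ℓ) → 1 ≤ ℓ → ℓ ≤ b → T (anyBelow p b)
anyBelow-complete p zero pℓ 1≤ℓ ℓ≤0 = contradiction ℓ≤0 (<⇒≱ 1≤ℓ)
anyBelow-complete p (suc b) pℓ 1≤ℓ ℓ≤1+b with p (suc b) in e
... | true = _
... | false with m≤n⇒m<n∨m≡n ℓ≤1+b
...   | inj₁ ℓ<1+b = anyBelow-complete p b pℓ 1≤ℓ (s≤s⁻¹ ℓ<1+b)
...   | inj₂ refl = ⊥-elim (subst T e pℓ)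

minBelow-just : ∀ p b {k} → minBelow p b ≡ just k → 1 ≤ k × k ≤ b × T (p k)
minBelow-just p (suc b) found with minBelow p b in e
... | just j with refl ← found = let 1≤j , j≤b , pj = minBelow-just p b e in 1≤j , m≤n⇒m≤1+n j≤b , pj
... | nothing with p (suc b) in e′
...   | true with refl ← found = z<s , ≤-refl , Equivalence.from T-≡ e′

minBelow-nothing : ∀ p b → minBelow p b ≡ nothing → ∀ {k} → 1 ≤ k → k ≤ b → ¬ T (p k)
minBelow-nothing p zero none 1≤k k≤0 = contradiction k≤0 (<⇒≱ 1≤k)
minBelow-nothing p (suc b) none {k} 1≤k k≤1+b with minBelow p b in e
... | nothing with p (suc b) in e′
...   | false with m≤n⇒m<n∨m≡n k≤1+b
...     | inj₁ k<1+b = minBelow-nothing p b e 1≤k (s≤s⁻¹ k<1+b)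
...     | inj₂ refl = subst T e′

module _ (h : ℕ → ℕ → Bool) (b : ℕ) where

  maxExponent : ℕ
  maxExponent = maxBelow (λ n → anyBelow (h n) b) b

  maxExponent-maximal : ∀ {n ℓ} → T (h n ℓ) → 1 ≤ n → n ≤ b → 1 ≤ ℓ → ℓ ≤ b → n ≤ maxExponent
  maxExponent-maximal hnℓ 1≤n n≤b 1≤ℓ ℓ≤b =
    maxBelow-maximal _ b (anyBelow-complete (h _) b hnℓ 1≤ℓ ℓ≤b) 1≤n n≤b

  maxRoot-spec : 1 ≤ maxExponent →
    1 ≤ maxBelow (h maxExponent) b × T (h maxExponent (maxBelow (h maxExponent) b))
  maxRoot-spec 1≤max with anyBelow-sound (h maxExponent) b (maxBelow-satisfies _ b 1≤max)
  ... | ℓ , 1≤ℓ , ℓ≤b , hℓ =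
    let 1≤root = ≤-trans 1≤ℓ (maxBelow-maximal (h maxExponent) b hℓ 1≤ℓ ℓ≤b)
    in 1≤root , maxBelow-satisfies (h maxExponent) b 1≤root

module _ (g : ℕ → ℕ) (b : ℕ) where

  firstNonUnit-just : ∀ {ℓ} → minBelow (λ ℓ → (ℓ <ᵇ b) ∧ not (g ℓ ≡ᵇ 1)) b ≡ just ℓ →
    1 ≤ ℓ × ℓ < b × g ℓ ≢ 1
  firstNonUnit-just found =
    let 1≤ℓ , _ , pℓ = minBelow-just _ b found
        ℓ<ᵇb , g≢ᵇ1 = Equivalence.to T-∧ pℓ
    in 1≤ℓ , <ᵇ⇒< _ b ℓ<ᵇb , λ g≡1 → subst T (Equivalence.to T-not-≡ g≢ᵇ1) (≡⇒≡ᵇ _ 1 g≡1)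

  firstNonUnit-nothing : minBelow (λ ℓ → (ℓ <ᵇ b) ∧ not (g ℓ ≡ᵇ 1)) b ≡ nothing →
    ∀ ℓ → 1 ≤ ℓ → ℓ < b → g ℓ ≡ 1
  firstNonUnit-nothing none ℓ 1≤ℓ ℓ<b with g ℓ ≡ᵇ 1 in e
  ... | true = ≡ᵇ⇒≡ (g ℓ) 1 (Equivalence.from T-≡ e)
  ... | false = contradiction (Equivalence.from T-∧ (<⇒<ᵇ ℓ<b , Equivalence.from T-not-≡ e))
                              (minBelow-nothing _ b none 1≤ℓ (<⇒≤ ℓ<b))

factor≤ : ∀ {n ℓ m} → 1 ≤ n → n * ℓ ≤ m → ℓ ≤ m
factor≤ {n} {ℓ} 1≤n nℓ≤m = ≤-trans (m≤n*m ℓ n {{>-nonZero 1≤n}}) nℓ≤m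

iter-shift : ∀ {a} {X : Set a} (f : X → X) n x → iter f n (f x) ≡ iter f (suc n) x
iter-shift f zero x = refl
iter-shift f (suc n) x = cong f (iter-shift f n x)

≢-≢⇒≡-Fin2 : {i j k : Fin 2} → i ≢ j → j ≢ k → i ≡ k
≢-≢⇒≡-Fin2 {zero} {zero} i≢j _ = contradiction refl i≢j
≢-≢⇒≡-Fin2 {suc zero} {suc zero} i≢j _ = contradiction refl i≢j
≢-≢⇒≡-Fin2 {_} {zero} {zero} _ j≢k = contradiction refl j≢k
≢-≢⇒≡-Fin2 {_} {suc zero} {suc zero} _ j≢k = contradiction refl j≢k
≢-≢⇒≡-Fin2 {zero} {suc zero} {zero} _ _ = refl
≢-≢⇒≡-Fin2 {suc zero} {zero} {suc zero} _ _ = refl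

module _ {a} {A : Set a} where

  head-++ : ∀ (u v : List A) → head (u ++ v) ≡ head u <∣> head v
  head-++ [] v = refl
  head-++ (x ∷ u) v = refl

  last-∷-<∣> : ∀ x (v : List A) m → last (x ∷ v) <∣> m ≡ last (x ∷ v)
  last-∷-<∣> x [] m = refl
  last-∷-<∣> x (y ∷ v) m = last-∷-<∣> y v m

  last-++ : ∀ (u v : List A) → last (u ++ v) ≡ last v <∣> last u
  last-++ [] v = sym (<∣>-identityʳ (last v))
  last-++ (x ∷ []) [] = refl
  last-++ (x ∷ []) (y ∷ v) = sym (last-∷-<∣> y v (just x))
  last-++ (x ∷ y ∷ u) v = last-++ (y ∷ u) v

  ≢[]⇒1≤length : ∀ (u : List A) → u ≢ [] → 1 ≤ length u
  ≢[]⇒1≤length [] u≢[] = contradiction refl u≢[]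
  ≢[]⇒1≤length (_ ∷ _) _ = z<s

  length-++-<ˡ : ∀ (u : List A) {v} → 1 ≤ length v → length u < length (u ++ v)
  length-++-<ˡ u 1≤|v| = subst (length u <_) (sym (length-++ u)) (m<m+n (length u) 1≤|v|)

  length-++-<ʳ : ∀ (v : List A) {u} → 1 ≤ length u → length v < length (u ++ v)
  length-++-<ʳ v {u} 1≤|u| = subst (length v <_) (length-++-comm v u) (length-++-<ˡ v 1≤|u|)

module Prints {a} {A : Set a} (_≟_ : DecidableEquality A) where

  open Words _≟_

  ==⇒≡ : ∀ {u v} → T (u == v) → u ≡ v
  ==⇒≡ {u} {v} = toWitness {a? = ≡-dec _≟_ u v}

  ≡⇒== : ∀ {u v} → u ≡ v → T (u == v)
  ≡⇒== {u} {v} = fromWitness {a? = ≡-dec _≟_ u v}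

  ==-refl : ∀ u → T (u == u)
  ==-refl u = ≡⇒== {u} refl

  length-pow : ∀ v n → length (pow v n) ≡ n * length v
  length-pow v zero = refl
  length-pow v (suc n) = trans (length-++ v) (cong (length v +_) (length-pow v n))

  length-pow-pos : ∀ v {n} → 1 ≤ length v → 1 ≤ n → 1 ≤ length (pow v n)
  length-pow-pos (_ ∷ _) {suc _} _ _ = z<s

  pow-≡⇒exponent≡1 : ∀ {v n} → 1 ≤ length v → v ≡ pow v n → n ≡ 1
  pow-≡⇒exponent≡1 {v} {n} 1≤|v| v≡vⁿ = sym (*-cancelʳ-≡ 1 n (length v) {{>-nonZero 1≤|v|}}
    (trans (+-identityʳ (length v)) (trans (cong length v≡vⁿ) (length-pow v n))))

  last-pow : ∀ v {n} → 1 ≤ length v → 1 ≤ n → last (pow v n) ≡ last v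
  last-pow v {suc zero} _ _ = cong last (++-identityʳ v)
  last-pow v@(x ∷ v′) {suc (suc n)} 1≤|v| _ = begin
    last (v ++ pow v (suc n))         ≡⟨ last-++ v (pow v (suc n)) ⟩
    last (pow v (suc n)) <∣> last v   ≡⟨ cong (_<∣> last v) (last-pow v {suc n} 1≤|v| z<s) ⟩
    last v <∣> last v                 ≡⟨ last-∷-<∣> x v′ (last v) ⟩
    last v                            ∎
    where open ≡-Reasoning

  pow-⊆ : ∀ v n → pow v n ⊆ v
  pow-⊆ v (suc n) y∈ with ∈-++⁻ v y∈
  ... | inj₁ y∈v = y∈v
  ... | inj₂ y∈vⁿ = pow-⊆ v n y∈vⁿ

  -- A print step turns u · v^n into u′ · v (or v^n · u into v · u′) with u′ the print of u.
  record Compatible (R : Word → Word → Set a) : Set a where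
    field
      []-compat : R [] []
      ++-compat : ∀ {u u′ v v′} → R u u′ → R v v′ → R (u ++ v) (u′ ++ v′)
      pow-compat : ∀ {v n} → 1 ≤ length v → 1 ≤ n → R v (pow v n)

  open Compatible

  _⊑_ : Word → Word → Set a
  u ⊑ v = u ≡ v ⊎ length u < length v

  ⊑⇒≤ : ∀ {u v} → u ⊑ v → length u ≤ length v
  ⊑⇒≤ (inj₁ refl) = ≤-refl
  ⊑⇒≤ (inj₂ |u|<|v|) = <⇒≤ |u|<|v|

  length-++-strictˡ : ∀ (u u′ : Word) {v v′ : Word} →
    length u < length u′ → v ⊑ v′ → length (u ++ v) < length (u′ ++ v′)
  length-++-strictˡ u u′ {v} {v′} |u|<|u′| v⊑v′ =
    subst₂ _<_ (sym (length-++ u {v})) (sym (length-++ u′ {v′})) (+-mono-<-≤ |u|<|u′| (⊑⇒≤ v⊑v′))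

  length-++-strictʳ : ∀ (u : Word) {v v′ : Word} → length v < length v′ → length (u ++ v) < length (u ++ v′)
  length-++-strictʳ u {v} {v′} |v|<|v′| =
    subst₂ _<_ (sym (length-++ u {v})) (sym (length-++ u {v′})) (+-monoʳ-< (length u) |v|<|v′|)

  ⊑-compatible : Compatible _⊑_
  ⊑-compatible .[]-compat = inj₁ refl
  ⊑-compatible .++-compat (inj₁ refl) (inj₁ refl) = inj₁ refl
  ⊑-compatible .++-compat {u} (inj₁ refl) (inj₂ |v|<|v′|) = inj₂ (length-++-strictʳ u |v|<|v′|)
  ⊑-compatible .++-compat {u} {u′} (inj₂ |u|<|u′|) v⊑v′ = inj₂ (length-++-strictˡ u u′ |u|<|u′| v⊑v′)
  ⊑-compatible .pow-compat {v} {suc zero} _ _ = inj₁ (sym (++-identityʳ v))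
  ⊑-compatible .pow-compat {v} {suc (suc n)} 1≤|v| _ = inj₂ (length-++-<ˡ v (length-pow-pos v {suc n} 1≤|v| z<s))

  ⊑-++⁻ : ∀ {u u′ v v′} → u ⊑ u′ → v ⊑ v′ → u ++ v ≡ u′ ++ v′ → u ≡ u′ × v ≡ v′
  ⊑-++⁻ (inj₁ refl) (inj₁ refl) _ = refl , refl
  ⊑-++⁻ {u} (inj₁ refl) (inj₂ |v|<|v′|) eq = contradiction (cong length eq) (<⇒≢ (length-++-strictʳ u |v|<|v′|))
  ⊑-++⁻ {u} {u′} (inj₂ |u|<|u′|) v⊑v′ eq =
    contradiction (cong length eq) (<⇒≢ (length-++-strictˡ u u′ |u|<|u′| v⊑v′))

  record _≈_ (u v : Word) : Set a where
    field
      head≡ : head u ≡ head v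
      last≡ : last u ≡ last v
      letters⊆ : u ⊆ v
      letters⊇ : v ⊆ u

  open _≈_

  ≈-refl : ∀ {u} → u ≈ u
  ≈-refl = record { head≡ = refl ; last≡ = refl ; letters⊆ = ⊆-refl ; letters⊇ = ⊆-refl }

  ≈-sym : ∀ {u v} → u ≈ v → v ≈ u
  ≈-sym u≈v = record
    { head≡ = sym (head≡ u≈v) ; last≡ = sym (last≡ u≈v) ; letters⊆ = letters⊇ u≈v ; letters⊇ = letters⊆ u≈v }

  ≈-trans : ∀ {u v w} → u ≈ v → v ≈ w → u ≈ w
  ≈-trans u≈v v≈w = record
    { head≡ = trans (head≡ u≈v) (head≡ v≈w)
    ; last≡ = trans (last≡ u≈v) (last≡ v≈w)
    ; letters⊆ = ⊆-trans (letters⊆ u≈v) (letters⊆ v≈w)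
    ; letters⊇ = ⊆-trans (letters⊇ v≈w) (letters⊇ u≈v)
    }

  ≈-compatible : Compatible _≈_
  ≈-compatible .[]-compat = ≈-refl
  ≈-compatible .++-compat {u} {u′} {v} {v′} u≈u′ v≈v′ = record
    { head≡ = trans (head-++ u v) (trans (cong₂ _<∣>_ (head≡ u≈u′) (head≡ v≈v′)) (sym (head-++ u′ v′)))
    ; last≡ = trans (last-++ u v) (trans (cong₂ _<∣>_ (last≡ v≈v′) (last≡ u≈u′)) (sym (last-++ u′ v′)))
    ; letters⊆ = ++⁺ (letters⊆ u≈u′) (letters⊆ v≈v′)
    ; letters⊇ = ++⁺ (letters⊇ u≈u′) (letters⊇ v≈v′)
    }
  ≈-compatible .pow-compat {v@(_ ∷ _)} {n@(suc m)} 1≤|v| 1≤n = record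
    { head≡ = refl
    ; last≡ = sym (last-pow v 1≤|v| 1≤n)
    ; letters⊆ = xs⊆xs++ys v (pow v m)
    ; letters⊇ = pow-⊆ v n
    }

  ≈-nonempty : ∀ {u v} → u ≈ v → 1 ≤ length v → 1 ≤ length u
  ≈-nonempty {[]} {_ ∷ _} u≈v _ with () ← head≡ u≈v
  ≈-nonempty {_ ∷ _} _ _ = z<s

  length-suffix : ∀ {k} w → k ≤ length w → length (suffix k w) ≡ k
  length-suffix {k} w k≤|w| = trans (length-drop (length w ∸ k) w) (m∸[m∸n]≡n k≤|w|)

  length-prefixWithout : ∀ k w → length (prefixWithout k w) ≡ length w ∸ k
  length-prefixWithout k w = trans (length-take (length w ∸ k) w) (m≤n⇒m⊓n≡m (m∸n≤m (length w) k))

  restR rootR : Word → Word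
  restR w = proj₁ (ρr w)
  rootR w = proj₁ (proj₂ (ρr w))

  hasRightPow-sound : ∀ w n ℓ → T (hasRightPow w n ℓ) → n * ℓ ≤ length w × suffix (n * ℓ) w ≡ pow (suffix ℓ w) n
  hasRightPow-sound w n ℓ has =
    let fits , matches = Equivalence.to T-∧ has in ≤ᵇ⇒≤ (n * ℓ) (length w) fits , ==⇒≡ matches

  hasRightPow-1 : ∀ w {ℓ} → ℓ ≤ length w → T (hasRightPow w 1 ℓ)
  hasRightPow-1 w {ℓ} ℓ≤|w| = Equivalence.from T-∧
    ( ≤⇒≤ᵇ (subst (_≤ length w) (sym (*-identityˡ ℓ)) ℓ≤|w|)
    , ≡⇒== (trans (cong (λ k → suffix k w) (*-identityˡ ℓ)) (sym (++-identityʳ (suffix ℓ w)))) )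

  τr-maximal : ∀ w {n ℓ} → T (hasRightPow w n ℓ) →
    1 ≤ n → n ≤ length w → 1 ≤ ℓ → ℓ ≤ length w → n ≤ τr w
  τr-maximal w = maxExponent-maximal (hasRightPow w) (length w)

  τr-pos : ∀ w → 1 ≤ length w → 1 ≤ τr w
  τr-pos w 1≤|w| = τr-maximal w (hasRightPow-1 w ≤-refl) ≤-refl 1≤|w| 1≤|w| ≤-refl

  θr-pos-hasRightPow : ∀ w → 1 ≤ length w → 1 ≤ θr w × T (hasRightPow w (τr w) (θr w))
  θr-pos-hasRightPow w 1≤|w| with τr w ≡ᵇ 1 in τ≡ᵇ1
  ... | false = maxRoot-spec (hasRightPow w) (length w) (τr-pos w 1≤|w|)
  ... | true with minBelow (λ ℓ → (ℓ <ᵇ length w) ∧ not (τr (prefixWithout ℓ w) ≡ᵇ 1)) (length w) in first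
  ...   | just ℓ = let 1≤ℓ , ℓ<|w| , _ = firstNonUnit-just (λ ℓ → τr (prefixWithout ℓ w)) (length w) first
                   in 1≤ℓ , subst (λ n → T (hasRightPow w n ℓ)) (sym τ≡1) (hasRightPow-1 w (<⇒≤ ℓ<|w|))
    where
    τ≡1 : τr w ≡ 1
    τ≡1 = ≡ᵇ⇒≡ (τr w) 1 (Equivalence.from T-≡ τ≡ᵇ1)
  ...   | nothing = 1≤|w| , subst (λ n → T (hasRightPow w n (length w))) (sym τ≡1) (hasRightPow-1 w ≤-refl)
    where
    τ≡1 : τr w ≡ 1
    τ≡1 = ≡ᵇ⇒≡ (τr w) 1 (Equivalence.from T-≡ τ≡ᵇ1)

  θr-unit : ∀ w → τr w ≡ 1 →
    (θr w < length w × τr (prefixWithout (θr w) w) ≢ 1) ⊎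
    (∀ ℓ → 1 ≤ ℓ → ℓ < length w → τr (prefixWithout ℓ w) ≡ 1)
  θr-unit w τ≡1 with τr w ≡ᵇ 1 in τ≡ᵇ1
  ... | false = ⊥-elim (subst T τ≡ᵇ1 (≡⇒≡ᵇ (τr w) 1 τ≡1))
  ... | true with minBelow (λ ℓ → (ℓ <ᵇ length w) ∧ not (τr (prefixWithout ℓ w) ≡ᵇ 1)) (length w) in first
  ...   | just ℓ = inj₁ (proj₂ (firstNonUnit-just (λ ℓ → τr (prefixWithout ℓ w)) (length w) first))
  ...   | nothing = inj₂ (firstNonUnit-nothing (λ ℓ → τr (prefixWithout ℓ w)) (length w) first)

  decompR : ∀ w → 1 ≤ length w → w ≡ restR w ++ pow (rootR w) (τr w)
  decompR w 1≤|w| = begin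
    w                                       ≡⟨ sym (take++drop≡id (length w ∸ θr w * τr w) w) ⟩
    restR w ++ suffix (θr w * τr w) w       ≡⟨ cong (λ k → restR w ++ suffix k w) (*-comm (θr w) (τr w)) ⟩
    restR w ++ suffix (τr w * θr w) w       ≡⟨ cong (restR w ++_) (proj₂ (hasRightPow-sound w (τr w) (θr w) has)) ⟩
    restR w ++ pow (rootR w) (τr w)         ∎
    where
    open ≡-Reasoning
    has : T (hasRightPow w (τr w) (θr w))
    has = proj₂ (θr-pos-hasRightPow w 1≤|w|)

  rootR-nonempty : ∀ w → 1 ≤ length w → 1 ≤ length (rootR w)
  rootR-nonempty w 1≤|w| =
    let 1≤θ , has = θr-pos-hasRightPow w 1≤|w|
    in subst (1 ≤_) (sym (length-suffix w (factor≤ (τr-pos w 1≤|w|) (proj₁ (hasRightPow-sound w (τr w) (θr w) has))))) 1≤θ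

  restR-fuel : ∀ {f} w → 1 ≤ length w → length w ≤ suc f → length (restR w) ≤ f
  restR-fuel w 1≤|w| |w|≤1+f = s≤s⁻¹ (≤-trans (subst (length (restR w) <_) (sym (cong length (decompR w 1≤|w|)))
    (length-++-<ˡ (restR w) (length-pow-pos (rootR w) (rootR-nonempty w 1≤|w|) (τr-pos w 1≤|w|)))) |w|≤1+f)

  gprRF-compatible : ∀ {R} → Compatible R → ∀ f w → length w ≤ f → R (gprRF f w) w
  gprRF-compatible C zero [] _ = []-compat C
  gprRF-compatible C (suc f) [] _ = []-compat C
  gprRF-compatible {R} C (suc f) w@(_ ∷ _) |w|≤1+f =
    subst (R (gprRF (suc f) w)) (sym (decompR w z<s))
      (++-compat C (gprRF-compatible C f (restR w) (restR-fuel w z<s |w|≤1+f))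
                   (pow-compat C (rootR-nonempty w z<s) (τr-pos w z<s)))

  gprRF-fixed⁻¹ : ∀ f w → 1 ≤ length w → length w ≤ suc f → gprRF (suc f) w ≡ w →
    gprRF f (restR w) ≡ restR w × τr w ≡ 1
  gprRF-fixed⁻¹ f w@(_ ∷ _) _ |w|≤1+f fixed =
    let rest-fixed , root≡rootⁿ = ⊑-++⁻ (gprRF-compatible ⊑-compatible f (restR w) (restR-fuel w z<s |w|≤1+f))
                                         (pow-compat ⊑-compatible (rootR-nonempty w z<s) (τr-pos w z<s))
                                         (trans fixed (decompR w z<s))
    in rest-fixed , pow-≡⇒exponent≡1 (rootR-nonempty w z<s) root≡rootⁿ

  gprRF-fixed⇒τr≡1 : ∀ f w → 1 ≤ length w → length w ≤ f → gprRF f w ≡ w → τr w ≡ 1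
  gprRF-fixed⇒τr≡1 zero w 1≤|w| |w|≤0 _ = contradiction |w|≤0 (<⇒≱ 1≤|w|)
  gprRF-fixed⇒τr≡1 (suc f) w 1≤|w| |w|≤1+f fixed = proj₂ (gprRF-fixed⁻¹ f w 1≤|w| |w|≤1+f fixed)

  -- In a fixed point of gprR the first step must take the whole word as its root,
  -- since otherwise the rest would have τr ≠ 1 and could not be fixed itself.
  gprR-fixed⇒prefixes-τr≡1 : ∀ c → gprR c ≡ c → ∀ k → 1 ≤ k → k ≤ length c → τr (take k c) ≡ 1
  gprR-fixed⇒prefixes-τr≡1 [] _ k 1≤k k≤0 = contradiction k≤0 (<⇒≱ 1≤k)
  gprR-fixed⇒prefixes-τr≡1 c@(_ ∷ w) fixed k 1≤k k≤|c|
    with rest-fixed , τ≡1 ← gprRF-fixed⁻¹ (length w) c z<s ≤-refl fixed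
    with θr-unit c τ≡1
  ... | inj₁ (θ<|c| , τ[rest]≢1) = contradiction τ[rest]≡1 τ[rest]≢1
    where
    rest≡ : restR c ≡ prefixWithout (θr c) c
    rest≡ = cong (λ n → prefixWithout n c) (trans (cong (θr c *_) τ≡1) (*-identityʳ (θr c)))
    1≤|rest| : 1 ≤ length (prefixWithout (θr c) c)
    1≤|rest| = subst (1 ≤_) (sym (length-prefixWithout (θr c) c)) (m<n⇒0<n∸m θ<|c|)
    τ[rest]≡1 : τr (prefixWithout (θr c) c) ≡ 1
    τ[rest]≡1 = gprRF-fixed⇒τr≡1 (length w) _ 1≤|rest|
                  (subst (λ u → length u ≤ length w) rest≡ (restR-fuel c z<s ≤-refl))
                  (subst (λ u → gprRF (length w) u ≡ u) rest≡ rest-fixed)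
  ... | inj₂ proper-prefixes with m≤n⇒m<n∨m≡n k≤|c|
  ...   | inj₂ refl = trans (cong τr (take-all k c ≤-refl)) τ≡1
  ...   | inj₁ k<|c| = subst (λ n → τr (take n c) ≡ 1) (m∸[m∸n]≡n k≤|c|)
                         (proper-prefixes (length c ∸ k) (m<n⇒0<n∸m k<|c|) (∸-monoʳ-< 1≤k k≤|c|))

  restL rootL : Word → Word
  restL w = proj₁ (ρl w)
  rootL w = proj₁ (proj₂ (ρl w))

  hasLeftPow-sound : ∀ w n ℓ → T (hasLeftPow w n ℓ) → n * ℓ ≤ length w × take (n * ℓ) w ≡ pow (take ℓ w) n
  hasLeftPow-sound w n ℓ has =
    let fits , matches = Equivalence.to T-∧ has in ≤ᵇ⇒≤ (n * ℓ) (length w) fits , ==⇒≡ matches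

  hasLeftPow-1 : ∀ w {ℓ} → ℓ ≤ length w → T (hasLeftPow w 1 ℓ)
  hasLeftPow-1 w {ℓ} ℓ≤|w| = Equivalence.from T-∧
    ( ≤⇒≤ᵇ (subst (_≤ length w) (sym (*-identityˡ ℓ)) ℓ≤|w|)
    , ≡⇒== (trans (cong (λ k → take k w) (*-identityˡ ℓ)) (sym (++-identityʳ (take ℓ w)))) )

  τl-maximal : ∀ w {n ℓ} → T (hasLeftPow w n ℓ) →
    1 ≤ n → n ≤ length w → 1 ≤ ℓ → ℓ ≤ length w → n ≤ τl w
  τl-maximal w = maxExponent-maximal (hasLeftPow w) (length w)

  τl-pos : ∀ w → 1 ≤ length w → 1 ≤ τl w
  τl-pos w 1≤|w| = τl-maximal w (hasLeftPow-1 w ≤-refl) ≤-refl 1≤|w| 1≤|w| ≤-refl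

  θl-pos-hasLeftPow : ∀ w → 1 ≤ length w → 1 ≤ θl w × T (hasLeftPow w (τl w) (θl w))
  θl-pos-hasLeftPow w 1≤|w| with τl w ≡ᵇ 1 in τ≡ᵇ1
  ... | false = maxRoot-spec (hasLeftPow w) (length w) (τl-pos w 1≤|w|)
  ... | true with minBelow (λ ℓ → (ℓ <ᵇ length w) ∧ not (τl (drop ℓ w) ≡ᵇ 1)) (length w) in first
  ...   | just ℓ = let 1≤ℓ , ℓ<|w| , _ = firstNonUnit-just (λ ℓ → τl (drop ℓ w)) (length w) first
                   in 1≤ℓ , subst (λ n → T (hasLeftPow w n ℓ)) (sym τ≡1) (hasLeftPow-1 w (<⇒≤ ℓ<|w|))
    where
    τ≡1 : τl w ≡ 1
    τ≡1 = ≡ᵇ⇒≡ (τl w) 1 (Equivalence.from T-≡ τ≡ᵇ1)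
  ...   | nothing = 1≤|w| , subst (λ n → T (hasLeftPow w n (length w))) (sym τ≡1) (hasLeftPow-1 w ≤-refl)
    where
    τ≡1 : τl w ≡ 1
    τ≡1 = ≡ᵇ⇒≡ (τl w) 1 (Equivalence.from T-≡ τ≡ᵇ1)

  θl-unit : ∀ w → τl w ≡ 1 →
    (θl w < length w × τl (drop (θl w) w) ≢ 1) ⊎
    (∀ ℓ → 1 ≤ ℓ → ℓ < length w → τl (drop ℓ w) ≡ 1)
  θl-unit w τ≡1 with τl w ≡ᵇ 1 in τ≡ᵇ1
  ... | false = ⊥-elim (subst T τ≡ᵇ1 (≡⇒≡ᵇ (τl w) 1 τ≡1))
  ... | true with minBelow (λ ℓ → (ℓ <ᵇ length w) ∧ not (τl (drop ℓ w) ≡ᵇ 1)) (length w) in first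
  ...   | just ℓ = inj₁ (proj₂ (firstNonUnit-just (λ ℓ → τl (drop ℓ w)) (length w) first))
  ...   | nothing = inj₂ (firstNonUnit-nothing (λ ℓ → τl (drop ℓ w)) (length w) first)

  decompL : ∀ w → 1 ≤ length w → w ≡ pow (rootL w) (τl w) ++ restL w
  decompL w 1≤|w| = begin
    w                                     ≡⟨ sym (take++drop≡id (θl w * τl w) w) ⟩
    take (θl w * τl w) w ++ restL w       ≡⟨ cong (λ k → take k w ++ restL w) (*-comm (θl w) (τl w)) ⟩
    take (τl w * θl w) w ++ restL w       ≡⟨ cong (_++ restL w) (proj₂ (hasLeftPow-sound w (τl w) (θl w) has)) ⟩
    pow (rootL w) (τl w) ++ restL w       ∎
    where
    open ≡-Reasoning
    has : T (hasLeftPow w (τl w) (θl w))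
    has = proj₂ (θl-pos-hasLeftPow w 1≤|w|)

  rootL-nonempty : ∀ w → 1 ≤ length w → 1 ≤ length (rootL w)
  rootL-nonempty w 1≤|w| =
    let 1≤θ , has = θl-pos-hasLeftPow w 1≤|w|
        θ≤|w| = factor≤ (τl-pos w 1≤|w|) (proj₁ (hasLeftPow-sound w (τl w) (θl w) has))
    in subst (1 ≤_) (sym (trans (length-take (θl w) w) (m≤n⇒m⊓n≡m θ≤|w|))) 1≤θ

  restL-fuel : ∀ {f} w → 1 ≤ length w → length w ≤ suc f → length (restL w) ≤ f
  restL-fuel w 1≤|w| |w|≤1+f = s≤s⁻¹ (≤-trans (subst (length (restL w) <_) (sym (cong length (decompL w 1≤|w|)))
    (length-++-<ʳ (restL w) {pow (rootL w) (τl w)}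
      (length-pow-pos (rootL w) (rootL-nonempty w 1≤|w|) (τl-pos w 1≤|w|)))) |w|≤1+f)

  gprLF-compatible : ∀ {R} → Compatible R → ∀ f w → length w ≤ f → R (gprLF f w) w
  gprLF-compatible C zero [] _ = []-compat C
  gprLF-compatible C (suc f) [] _ = []-compat C
  gprLF-compatible {R} C (suc f) w@(_ ∷ _) |w|≤1+f =
    subst (R (gprLF (suc f) w)) (sym (decompL w z<s))
      (++-compat C (pow-compat C (rootL-nonempty w z<s) (τl-pos w z<s))
                   (gprLF-compatible C f (restL w) (restL-fuel w z<s |w|≤1+f)))

  gprLF-fixed⁻¹ : ∀ f w → 1 ≤ length w → length w ≤ suc f → gprLF (suc f) w ≡ w →
    gprLF f (restL w) ≡ restL w × τl w ≡ 1
  gprLF-fixed⁻¹ f w@(_ ∷ _) _ |w|≤1+f fixed =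
    let root≡rootⁿ , rest-fixed = ⊑-++⁻ (pow-compat ⊑-compatible (rootL-nonempty w z<s) (τl-pos w z<s))
                                         (gprLF-compatible ⊑-compatible f (restL w) (restL-fuel w z<s |w|≤1+f))
                                         (trans fixed (decompL w z<s))
    in rest-fixed , pow-≡⇒exponent≡1 (rootL-nonempty w z<s) root≡rootⁿ

  gprLF-fixed⇒τl≡1 : ∀ f w → 1 ≤ length w → length w ≤ f → gprLF f w ≡ w → τl w ≡ 1
  gprLF-fixed⇒τl≡1 zero w 1≤|w| |w|≤0 _ = contradiction |w|≤0 (<⇒≱ 1≤|w|)
  gprLF-fixed⇒τl≡1 (suc f) w 1≤|w| |w|≤1+f fixed = proj₂ (gprLF-fixed⁻¹ f w 1≤|w| |w|≤1+f fixed)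

  gprL-fixed⇒suffixes-τl≡1 : ∀ c → gprL c ≡ c → ∀ k → k < length c → τl (drop k c) ≡ 1
  gprL-fixed⇒suffixes-τl≡1 c@(_ ∷ w) fixed k k<|c|
    with rest-fixed , τ≡1 ← gprLF-fixed⁻¹ (length w) c z<s ≤-refl fixed
    with θl-unit c τ≡1
  ... | inj₁ (θ<|c| , τ[rest]≢1) = contradiction τ[rest]≡1 τ[rest]≢1
    where
    rest≡ : restL c ≡ drop (θl c) c
    rest≡ = cong (λ n → drop n c) (trans (cong (θl c *_) τ≡1) (*-identityʳ (θl c)))
    1≤|rest| : 1 ≤ length (drop (θl c) c)
    1≤|rest| = subst (1 ≤_) (sym (length-drop (θl c) c)) (m<n⇒0<n∸m θ<|c|)
    τ[rest]≡1 : τl (drop (θl c) c) ≡ 1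
    τ[rest]≡1 = gprLF-fixed⇒τl≡1 (length w) _ 1≤|rest|
                  (subst (λ u → length u ≤ length w) rest≡ (restL-fuel c z<s ≤-refl))
                  (subst (λ u → gprLF (length w) u ≡ u) rest≡ rest-fixed)
  ... | inj₂ proper-suffixes with k
  ...   | zero = τ≡1
  ...   | suc k′ = proper-suffixes (suc k′) z<s k<|c|

  gprR-⊑ : ∀ u → gprR u ⊑ u
  gprR-⊑ u = gprRF-compatible ⊑-compatible (length u) u ≤-refl

  gprR-≈ : ∀ u → gprR u ≈ u
  gprR-≈ u = gprRF-compatible ≈-compatible (length u) u ≤-refl

  gprL-⊑ : ∀ u → gprL u ⊑ u
  gprL-⊑ u = gprLF-compatible ⊑-compatible (length u) u ≤-refl

  gprL-≈ : ∀ u → gprL u ≈ u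
  gprL-≈ u = gprLF-compatible ≈-compatible (length u) u ≤-refl

  module _ (G : Word → Word) where

    corePrint-bounded : (∀ u → G u ⊑ u) → ∀ n w → length w < n → Σ Word (IsCorePrint G w)
    corePrint-bounded shrinks (suc n) w |w|<1+n with shrinks w
    ... | inj₁ fixed = w , 0 , refl , fixed , λ _ ()
    ... | inj₂ shorter with corePrint-bounded shrinks n (G w) (<-≤-trans shorter (s≤s⁻¹ |w|<1+n))
    ...   | c , I , reached , c-fixed , minimal = c , suc I , trans (sym (iter-shift G I w)) reached , c-fixed , minimal′
      where
      minimal′ : ∀ J → J < suc I → iter G J w ≢ iter G (suc J) w
      minimal′ zero _ w≡Gw = <⇒≢ shorter (cong length (sym w≡Gw))
      minimal′ (suc J) J<I eq =
        minimal J (s<s⁻¹ J<I) (trans (iter-shift G J w) (trans eq (sym (iter-shift G (suc J) w))))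

    corePrint-exists : (∀ u → G u ⊑ u) → ∀ w → Σ Word (IsCorePrint G w)
    corePrint-exists shrinks w = corePrint-bounded shrinks (suc (length w)) w ≤-refl

    iter-≈ : (∀ u → G u ≈ u) → ∀ n w → iter G n w ≈ w
    iter-≈ similar zero w = ≈-refl
    iter-≈ similar (suc n) w = ≈-trans (similar (iter G n w)) (iter-≈ similar n w)

    corePrint-≈ : (∀ u → G u ≈ u) → ∀ {w c} → IsCorePrint G w c → c ≈ w
    corePrint-≈ similar {w} (I , refl , _) = iter-≈ similar I w

    corePrint-fixed : ∀ {w c} → IsCorePrint G w c → G c ≡ c
    corePrint-fixed (_ , _ , fixed , _) = fixed

  data CoreShape : Word → Set a where
    ⟨x⟩ : ∀ x → CoreShape (x ∷ [])
    ⟨xy⟩ : ∀ {x y} → x ≢ y → CoreShape (x ∷ y ∷ [])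
    ⟨xyx⟩ : ∀ {x y} → x ≢ y → CoreShape (x ∷ y ∷ x ∷ [])

  CoreShape-≈⇒≡ : ∀ {c c′} → CoreShape c → CoreShape c′ → c ≈ c′ → c ≡ c′
  CoreShape-≈⇒≡ (⟨x⟩ _) (⟨x⟩ _) ≈c′ with refl ← head≡ ≈c′ = refl
  CoreShape-≈⇒≡ (⟨x⟩ _) (⟨xy⟩ x≢y) ≈c′ with refl ← head≡ ≈c′ | refl ← last≡ ≈c′ = contradiction refl x≢y
  CoreShape-≈⇒≡ (⟨x⟩ _) (⟨xyx⟩ x≢y) ≈c′ with refl ← head≡ ≈c′ with letters⊇ ≈c′ (there (here refl))
  ... | here refl = contradiction refl x≢y
  CoreShape-≈⇒≡ (⟨xy⟩ x≢y) (⟨x⟩ _) ≈c′ with refl ← head≡ ≈c′ | refl ← last≡ ≈c′ = contradiction refl x≢y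
  CoreShape-≈⇒≡ (⟨xy⟩ _) (⟨xy⟩ _) ≈c′ with refl ← head≡ ≈c′ | refl ← last≡ ≈c′ = refl
  CoreShape-≈⇒≡ (⟨xy⟩ x≢y) (⟨xyx⟩ _) ≈c′ with refl ← head≡ ≈c′ | refl ← last≡ ≈c′ = contradiction refl x≢y
  CoreShape-≈⇒≡ (⟨xyx⟩ x≢y) (⟨x⟩ _) ≈c′ with refl ← head≡ ≈c′ with letters⊆ ≈c′ (there (here refl))
  ... | here refl = contradiction refl x≢y
  CoreShape-≈⇒≡ (⟨xyx⟩ _) (⟨xy⟩ x≢y) ≈c′ with refl ← head≡ ≈c′ | refl ← last≡ ≈c′ = contradiction refl x≢y
  CoreShape-≈⇒≡ (⟨xyx⟩ x≢y) (⟨xyx⟩ _) ≈c′ with refl ← head≡ ≈c′ with letters⊆ ≈c′ (there (here refl))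
  ... | here refl = contradiction refl x≢y
  ... | there (here refl) = refl
  ... | there (there (here refl)) = contradiction refl x≢y

  hasRightPow-square⇒τr≢1 : ∀ p ℓ → T (hasRightPow p 2 ℓ) → 1 ≤ ℓ → τr p ≢ 1
  hasRightPow-square⇒τr≢1 p ℓ square 1≤ℓ τ≡1 =
    let 2ℓ≤|p| = proj₁ (hasRightPow-sound p 2 ℓ square)
        2≤τ = τr-maximal p square z<s (≤-trans (*-monoʳ-≤ 2 1≤ℓ) 2ℓ≤|p|) 1≤ℓ (factor≤ {n = 2} z<s 2ℓ≤|p|)
    in 1+n≰n (subst (2 ≤_) τ≡1 2≤τ)

  hasLeftPow-square⇒τl≢1 : ∀ p ℓ → T (hasLeftPow p 2 ℓ) → 1 ≤ ℓ → τl p ≢ 1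
  hasLeftPow-square⇒τl≢1 p ℓ square 1≤ℓ τ≡1 =
    let 2ℓ≤|p| = proj₁ (hasLeftPow-sound p 2 ℓ square)
        2≤τ = τl-maximal p square z<s (≤-trans (*-monoʳ-≤ 2 1≤ℓ) 2ℓ≤|p|) 1≤ℓ (factor≤ {n = 2} z<s 2ℓ≤|p|)
    in 1+n≰n (subst (2 ≤_) τ≡1 2≤τ)

  τl≡1⇒head≢ : ∀ {x y} r → τl (x ∷ y ∷ r) ≡ 1 → x ≢ y
  τl≡1⇒head≢ {x} r τ≡1 refl = hasLeftPow-square⇒τl≢1 (x ∷ x ∷ r) 1 (==-refl (x ∷ x ∷ [])) z<s τ≡1

  module Binary (iso : A ↔ Fin 2) where

    ≢-≢⇒≡ : ∀ {x y z : A} → x ≢ y → y ≢ z → x ≡ z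
    ≢-≢⇒≡ x≢y y≢z = injective (≢-≢⇒≡-Fin2 (x≢y ∘ injective) (y≢z ∘ injective))
      where open Injection (↔⇒↣ iso)

    prefixes-τr≡1⇒CoreShape : ∀ c → 1 ≤ length c →
      (∀ k → 1 ≤ k → k ≤ length c → τr (take k c) ≡ 1) → CoreShape c
    prefixes-τr≡1⇒CoreShape (x ∷ []) _ _ = ⟨x⟩ x
    prefixes-τr≡1⇒CoreShape (x ∷ y ∷ r) _ unit with x ≟ y
    ... | yes refl = contradiction (unit 2 z<s (m≤m+n 2 (length r)))
                       (hasRightPow-square⇒τr≢1 (x ∷ x ∷ []) 1 (==-refl (x ∷ x ∷ [])) z<s)
    ... | no x≢y with r
    ...   | [] = ⟨xy⟩ x≢y
    ...   | z ∷ r′ with y ≟ z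
    ...     | yes refl = contradiction (unit 3 z<s (m≤m+n 3 (length r′)))
                           (hasRightPow-square⇒τr≢1 (x ∷ y ∷ y ∷ []) 1 (==-refl (y ∷ y ∷ [])) z<s)
    ...     | no y≢z with refl ← ≢-≢⇒≡ x≢y y≢z with r′
    ...       | [] = ⟨xyx⟩ x≢y
    ...       | u ∷ r″ with u ≟ x
    ...         | yes refl = contradiction (unit 4 z<s (m≤m+n 4 (length r″)))
                               (hasRightPow-square⇒τr≢1 (x ∷ y ∷ x ∷ x ∷ []) 1 (==-refl (x ∷ x ∷ [])) z<s)
    ...         | no u≢x with refl ← ≢-≢⇒≡ u≢x x≢y = contradiction (unit 4 z<s (m≤m+n 4 (length r″)))
                               (hasRightPow-square⇒τr≢1 (x ∷ y ∷ x ∷ y ∷ []) 2 (==-refl (x ∷ y ∷ x ∷ y ∷ [])) z<s)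

    suffixes-τl≡1⇒CoreShape : ∀ c → 1 ≤ length c → (∀ k → k < length c → τl (drop k c) ≡ 1) → CoreShape c
    suffixes-τl≡1⇒CoreShape (x ∷ []) _ _ = ⟨x⟩ x
    suffixes-τl≡1⇒CoreShape (x ∷ y ∷ r) _ unit
      with suffixes-τl≡1⇒CoreShape (y ∷ r) z<s (λ k → unit (suc k) ∘ s<s) | τl≡1⇒head≢ r (unit 0 z<s)
    ... | ⟨x⟩ _ | x≢y = ⟨xy⟩ x≢y
    ... | ⟨xy⟩ y≢z | x≢y with refl ← ≢-≢⇒≡ x≢y y≢z = ⟨xyx⟩ x≢y
    ... | ⟨xyx⟩ y≢z | x≢y with refl ← ≢-≢⇒≡ x≢y y≢z = contradiction (unit 0 z<s)
      (hasLeftPow-square⇒τl≢1 (x ∷ y ∷ x ∷ y ∷ []) 2 (==-refl (x ∷ y ∷ x ∷ y ∷ [])) z<s)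

    gprR-fixed⇒CoreShape : ∀ {c} → 1 ≤ length c → gprR c ≡ c → CoreShape c
    gprR-fixed⇒CoreShape {c} 1≤|c| fixed = prefixes-τr≡1⇒CoreShape c 1≤|c| (gprR-fixed⇒prefixes-τr≡1 c fixed)

    gprL-fixed⇒CoreShape : ∀ {c} → 1 ≤ length c → gprL c ≡ c → CoreShape c
    gprL-fixed⇒CoreShape {c} 1≤|c| fixed = suffixes-τl≡1⇒CoreShape c 1≤|c| (gprL-fixed⇒suffixes-τl≡1 c fixed)

theorem3p16 : ∀ {a} {A : Set a} (_≟_ : DecidableEquality A) → A ↔ Fin 2 →
    (w : List A) → ¬ (w ≡ []) →
    ∃ λ c → Words.IsCprR _≟_ w c × Words.IsCprL _≟_ w c
theorem3p16 _≟_ iso w w≢[] = cR , isCprR , subst (IsCprL w) (sym cR≡cL) isCprL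
  where
  open Words _≟_
  open Prints _≟_
  open Binary iso

  right : Σ Word (IsCprR w)
  right = corePrint-exists gprR gprR-⊑ w

  left : Σ Word (IsCprL w)
  left = corePrint-exists gprL gprL-⊑ w

  cR cL : Word
  cR = proj₁ right
  cL = proj₁ left

  isCprR : IsCprR w cR
  isCprR = proj₂ right

  isCprL : IsCprL w cL
  isCprL = proj₂ left

  cR≈w : cR ≈ w
  cR≈w = corePrint-≈ gprR gprR-≈ isCprR

  cL≈w : cL ≈ w
  cL≈w = corePrint-≈ gprL gprL-≈ isCprL

  cR≡cL : cR ≡ cL
  cR≡cL = CoreShape-≈⇒≡
    (gprR-fixed⇒CoreShape (≈-nonempty cR≈w 1≤|w|) (corePrint-fixed gprR isCprR))
    (gprL-fixed⇒CoreShape (≈-nonempty cL≈w 1≤|w|) (corePrint-fixed gprL isCprL))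
    (≈-trans cR≈w (≈-sym cL≈w))
    where
    1≤|w| : 1 ≤ length w
    1≤|w| = ≢[]⇒1≤length w w≢[]
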